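{- For all integers $n\ge1$, $$\sum_{m=0}^{n}\binom{n-\tfrac13}{m}\binom{n+\tfrac13}{n-m}(1-3n+6m)^{2n+1}=\left(\frac43\right)^n\frac{(3n+1)!}{n!}.$$
   Context: Binomial coefficients with non-integer upper argument are generalized binomial coefficients: $\binom{r}{m}=r(r-1)\cdots(r-m+1)/m!$ for integers $m\ge0$. -}

module Defs where

open import Data.Nat as ℕ using (ℕ; zero; suc)
open import Data.Nat.Properties using (_!≢0)
open import Data.Integer as ℤ using (ℤ; +_)
open import Data.Rational using (ℚ; _+_; _*_; _-_; _/_; 0ℚ; 1ℚ)
open import Data.Nat.Combinatorics using ()
open import Data.Nat using (_!)

ℕ→ℚ : ℕ → ℚ
ℕ→ℚ n = + n / 1

ℤ→ℚ : ℤ → ℚ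
ℤ→ℚ z = z / 1

_^ℚ_ : ℚ → ℕ → ℚ
q ^ℚ zero = 1ℚ
q ^ℚ suc k = q * (q ^ℚ k)

fallingFactorial : ℚ → ℕ → ℚ
fallingFactorial r zero = 1ℚ
fallingFactorial r (suc k) = fallingFactorial r k * (r - ℕ→ℚ k)

binom : ℚ → ℕ → ℚ
binom r m = fallingFactorial r m * ((+ 1 / (m !)) {{m !≢0}})

sumTo : ℕ → (ℕ → ℚ) → ℚ
sumTo zero f = f zero
sumTo (suc n) f = sumTo n f + f (suc n)

-- Put w_m = x + 2m − n (node) and c_m = C(n − x, m) C(n + x, n − m) w_m (weight). For non-integral x
-- the moments S_n(x, j) = Σ_m c_m (w_m²)^j (binomialMoment) vanish for j < n, and
-- S_n(x, n) = (−4)^n (x + n)(x + n − 1)⋯(x − n) (topMoment). The absorption identities for generalized binomial coefficients show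
-- that removing the last node (w_{n+1}² = (x + n + 1)²) or the first node (w_0² = (x − n − 1)²) from
-- the moment sequence at level n + 1 yields a multiple of the level-n moments at x − 1 or x + 1:
--   S_{n+1}(x, j+1) − w_{n+1}² S_{n+1}(x, j) = κ⁻ S_n(x − 1, j),
--   S_{n+1}(x, j+1) − w_0²     S_{n+1}(x, j) = κ⁺ S_n(x + 1, j).
-- Subtracting, −4x(n + 1) S_{n+1}(x, j) = κ⁻ S_n(x − 1, j) − κ⁺ S_n(x + 1, j), which vanishes for
-- j ≤ n by induction (for j = n both terms equal the new top moment); the first recurrence with j = n
-- then gives the top moment. At x = 1/3 one has 1 − 3n + 6m = 3 w_m, so the sum in question is
-- 3^{2n+1} S_n(1/3, n) = (−4)^n ∏_{k=1}^{n} (1 − 3k)(1 + 3k) = (4/3)^n (3n+1)!/n!.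

module Submission where

open import Defs
open import Data.Nat as ℕ using (ℕ; zero; suc; _!; _≥_)
import Data.Nat.Properties as ℕ
open import Data.Nat.Properties using (_!≢0)
open import Data.Nat.Coprimality using (1-coprimeTo)
open import Data.Integer as ℤ using (+_; -[1+_])
import Data.Integer.Properties as ℤ
open import Data.Rational using (ℚ; _+_; _*_; _-_; -_; _/_; 0ℚ; 1ℚ; 1/_; ≢-nonZero)
open import Data.Rational.Literals using (fromℤ; negative)
open import Data.Rational.Properties
  using (+-*-commutativeRing; _≟_; normalize-coprime; /-cong; *-inverseˡ; *-identityˡ; *-identityʳ; *-assoc; *-zeroʳ; *-distribˡ-+; +-assoc; +-inverseʳ)
open import Data.Unit using (tt)
open import Data.Product using (_×_; _,_; proj₁; proj₂)
open import Data.Sum using (inj₁; inj₂)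
open import Level using (0ℓ)
open import Relation.Nullary.Decidable using (dec⇒maybe)
open import Relation.Binary.PropositionalEquality
open import Tactic.RingSolver using (solve-∀)
import Tactic.RingSolver.Core.AlmostCommutativeRing as ACR

open ≡-Reasoning

instance
  ℚ-negative = negative
  literal-constraint = tt

ℚ-ring : ACR.AlmostCommutativeRing 0ℓ 0ℓ
ℚ-ring = ACR.fromCommutativeRing +-*-commutativeRing (λ q → dec⇒maybe (0ℚ ≟ q))

ℤ→ℚ≡fromℤ : ∀ z → ℤ→ℚ z ≡ fromℤ z
ℤ→ℚ≡fromℤ (+ n)    = normalize-coprime {n} {0} _
ℤ→ℚ≡fromℤ -[1+ n ] = cong -_ (normalize-coprime {suc n} {0} _)

ℤ→ℚ-homo-+ : ∀ a b → ℤ→ℚ (a ℤ.+ b) ≡ ℤ→ℚ a + ℤ→ℚ b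
ℤ→ℚ-homo-+ a b rewrite ℤ→ℚ≡fromℤ a | ℤ→ℚ≡fromℤ b =
  /-cong (cong₂ ℤ._+_ (sym (ℤ.*-identityʳ a)) (sym (ℤ.*-identityʳ b))) refl

ℤ→ℚ-homo-* : ∀ a b → ℤ→ℚ (a ℤ.* b) ≡ ℤ→ℚ a * ℤ→ℚ b
ℤ→ℚ-homo-* a b rewrite ℤ→ℚ≡fromℤ a | ℤ→ℚ≡fromℤ b = refl

ℤ→ℚ-homo‿- : ∀ a → ℤ→ℚ (ℤ.- a) ≡ - ℤ→ℚ a
ℤ→ℚ-homo‿- a rewrite ℤ→ℚ≡fromℤ (ℤ.- a) | ℤ→ℚ≡fromℤ a with a
... | + zero   = refl
... | + suc n  = refl
... | -[1+ n ] = refl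

ℕ→ℚ-homo-+ : ∀ m n → ℕ→ℚ (m ℕ.+ n) ≡ ℕ→ℚ m + ℕ→ℚ n
ℕ→ℚ-homo-+ m n = trans (cong ℤ→ℚ (ℤ.pos-+ m n)) (ℤ→ℚ-homo-+ (+ m) (+ n))

ℕ→ℚ-homo-* : ∀ m n → ℕ→ℚ (m ℕ.* n) ≡ ℕ→ℚ m * ℕ→ℚ n
ℕ→ℚ-homo-* m n = trans (cong ℤ→ℚ (ℤ.pos-* m n)) (ℤ→ℚ-homo-* (+ m) (+ n))

ℕ→ℚ-suc : ∀ n → ℕ→ℚ (suc n) ≡ 1ℚ + ℕ→ℚ n
ℕ→ℚ-suc = ℕ→ℚ-homo-+ 1

ℕ→ℚ-∸ : ∀ {m n} → m ℕ.≤ n → ℕ→ℚ (n ℕ.∸ m) ≡ ℕ→ℚ n - ℕ→ℚ m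
ℕ→ℚ-∸ {m} {n} m≤n = begin
  ℕ→ℚ (n ℕ.∸ m)                     ≡⟨ add-sub (ℕ→ℚ (n ℕ.∸ m)) (ℕ→ℚ m) ⟩
  ℕ→ℚ m + ℕ→ℚ (n ℕ.∸ m) - ℕ→ℚ m   ≡⟨ cong (_- ℕ→ℚ m) (sym (ℕ→ℚ-homo-+ m (n ℕ.∸ m))) ⟩
  ℕ→ℚ (m ℕ.+ (n ℕ.∸ m)) - ℕ→ℚ m   ≡⟨ cong (λ k → ℕ→ℚ k - ℕ→ℚ m) (ℕ.m+[n∸m]≡n m≤n) ⟩
  ℕ→ℚ n - ℕ→ℚ m                     ∎
  where
  add-sub : ∀ a b → a ≡ b + a - b
  add-sub = solve-∀ ℚ-ring

ℕ→ℚ-suc≢0 : ∀ n → ℕ→ℚ (suc n) ≢ 0ℚ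
ℕ→ℚ-suc≢0 n eq with trans (sym (ℤ→ℚ≡fromℤ (+ suc n))) eq
... | ()

x≢0⇒x*y≡0⇒y≡0 : ∀ {x y} → x ≢ 0ℚ → x * y ≡ 0ℚ → y ≡ 0ℚ
x≢0⇒x*y≡0⇒y≡0 {x} {y} x≢0 xy≡0 = begin
  y                ≡⟨ sym (*-identityˡ y) ⟩
  1ℚ * y           ≡⟨ cong (_* y) (sym (*-inverseˡ x)) ⟩
  (1/ x) * x * y   ≡⟨ *-assoc (1/ x) x y ⟩
  (1/ x) * (x * y) ≡⟨ cong ((1/ x) *_) xy≡0 ⟩
  (1/ x) * 0ℚ      ≡⟨ *-zeroʳ (1/ x) ⟩
  0ℚ               ∎
  where
  instance _ = ≢-nonZero x≢0

1/n*n≡1 : ∀ n .{{_ : ℕ.NonZero n}} → (+ 1 / n) * ℕ→ℚ n ≡ 1ℚ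
1/n*n≡1 (suc d) rewrite normalize-coprime {1} {d} (1-coprimeTo (suc d)) | ℤ→ℚ≡fromℤ (+ suc d) =
  *-inverseˡ (fromℤ (+ suc d))

/-split : ∀ a b .{{_ : ℕ.NonZero b}} → + a / b ≡ ℕ→ℚ a * (+ 1 / b)
/-split a (suc d) rewrite normalize-coprime {1} {d} (1-coprimeTo (suc d)) | ℤ→ℚ≡fromℤ (+ a) =
  /-cong (sym (ℤ.*-identityʳ (+ a))) (sym (ℕ.*-identityˡ (suc d)))

1/! : ℕ → ℚ
1/! k = (+ 1 / k !) {{k !≢0}}

1/!-suc : ∀ k → 1/! (suc k) * ℕ→ℚ (suc k) ≡ 1/! k
1/!-suc k = begin
  1/! (suc k) * ℕ→ℚ (suc k)                               ≡⟨ sym (*-identityʳ _) ⟩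
  1/! (suc k) * ℕ→ℚ (suc k) * 1ℚ                          ≡⟨ cong (1/! (suc k) * ℕ→ℚ (suc k) *_) (sym (1/n*n≡1 (k !) {{k !≢0}})) ⟩
  1/! (suc k) * ℕ→ℚ (suc k) * (1/! k * ℕ→ℚ (k !))         ≡⟨ regroup (1/! (suc k)) (ℕ→ℚ (suc k)) (1/! k) (ℕ→ℚ (k !)) ⟩
  1/! (suc k) * (ℕ→ℚ (suc k) * ℕ→ℚ (k !)) * 1/! k         ≡⟨ cong (λ q → 1/! (suc k) * q * 1/! k) (sym (ℕ→ℚ-homo-* (suc k) (k !))) ⟩
  1/! (suc k) * ℕ→ℚ (suc k !) * 1/! k                     ≡⟨ cong (_* 1/! k) (1/n*n≡1 (suc k !) {{suc k !≢0}}) ⟩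
  1ℚ * 1/! k                                              ≡⟨ *-identityˡ (1/! k) ⟩
  1/! k                                                   ∎
  where
  regroup : ∀ a b c d → a * b * (c * d) ≡ a * (b * d) * c
  regroup = solve-∀ ℚ-ring

^ℚ-distribʳ-* : ∀ a b k → (a * b) ^ℚ k ≡ a ^ℚ k * b ^ℚ k
^ℚ-distribʳ-* a b zero    = refl
^ℚ-distribʳ-* a b (suc k) = begin
  a * b * (a * b) ^ℚ k         ≡⟨ cong (a * b *_) (^ℚ-distribʳ-* a b k) ⟩
  a * b * (a ^ℚ k * b ^ℚ k)    ≡⟨ interchange a b (a ^ℚ k) (b ^ℚ k) ⟩
  a * a ^ℚ k * (b * b ^ℚ k)    ∎
  where
  interchange : ∀ a b c d → a * b * (c * d) ≡ a * c * (b * d)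
  interchange = solve-∀ ℚ-ring

2[1+n]+1≡2+[2n+1] : ∀ n → 2 ℕ.* suc n ℕ.+ 1 ≡ suc (suc (2 ℕ.* n ℕ.+ 1))
2[1+n]+1≡2+[2n+1] n = cong (ℕ._+ 1) (ℕ.*-suc 2 n)

^ℚ-odd : ∀ a n → a ^ℚ (2 ℕ.* n ℕ.+ 1) ≡ a * (a * a) ^ℚ n
^ℚ-odd a zero    = refl
^ℚ-odd a (suc n) = begin
  a ^ℚ (2 ℕ.* suc n ℕ.+ 1)       ≡⟨ cong (a ^ℚ_) (2[1+n]+1≡2+[2n+1] n) ⟩
  a * (a * a ^ℚ (2 ℕ.* n ℕ.+ 1)) ≡⟨ cong (λ p → a * (a * p)) (^ℚ-odd a n) ⟩
  a * (a * (a * (a * a) ^ℚ n))   ≡⟨ regroup a ((a * a) ^ℚ n) ⟩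
  a * (a * a * (a * a) ^ℚ n)     ∎
  where
  regroup : ∀ a p → a * (a * (a * p)) ≡ a * (a * a * p)
  regroup = solve-∀ ℚ-ring

fallingFactorial-+1 : ∀ r k → fallingFactorial (r + 1ℚ) (suc k) ≡ (r + 1ℚ) * fallingFactorial r k
fallingFactorial-+1 r zero    = base r
  where
  base : ∀ r → 1ℚ * (r + 1ℚ - 0ℚ) ≡ (r + 1ℚ) * 1ℚ
  base = solve-∀ ℚ-ring
fallingFactorial-+1 r (suc k) = begin
  fallingFactorial (r + 1ℚ) (suc k) * (r + 1ℚ - ℕ→ℚ (suc k))
    ≡⟨ cong₂ (λ p q → p * (r + 1ℚ - q)) (fallingFactorial-+1 r k) (ℕ→ℚ-suc k) ⟩
  (r + 1ℚ) * fallingFactorial r k * (r + 1ℚ - (1ℚ + ℕ→ℚ k))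
    ≡⟨ regroup r (fallingFactorial r k) (ℕ→ℚ k) ⟩
  (r + 1ℚ) * (fallingFactorial r k * (r - ℕ→ℚ k)) ∎
  where
  regroup : ∀ r p k → (r + 1ℚ) * p * (r + 1ℚ - (1ℚ + k)) ≡ (r + 1ℚ) * (p * (r - k))
  regroup = solve-∀ ℚ-ring

binom-absorb : ∀ r k → binom (r + 1ℚ) (suc k) * ℕ→ℚ (suc k) ≡ (r + 1ℚ) * binom r k
binom-absorb r k = begin
  fallingFactorial (r + 1ℚ) (suc k) * 1/! (suc k) * ℕ→ℚ (suc k)
    ≡⟨ *-assoc (fallingFactorial (r + 1ℚ) (suc k)) (1/! (suc k)) (ℕ→ℚ (suc k)) ⟩
  fallingFactorial (r + 1ℚ) (suc k) * (1/! (suc k) * ℕ→ℚ (suc k))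
    ≡⟨ cong₂ _*_ (fallingFactorial-+1 r k) (1/!-suc k) ⟩
  (r + 1ℚ) * fallingFactorial r k * 1/! k
    ≡⟨ *-assoc (r + 1ℚ) (fallingFactorial r k) (1/! k) ⟩
  (r + 1ℚ) * binom r k ∎

binom-absorb-complement : ∀ r k → binom (r + 1ℚ) k * (r + 1ℚ - ℕ→ℚ k) ≡ (r + 1ℚ) * binom r k
binom-absorb-complement r k = begin
  fallingFactorial (r + 1ℚ) k * 1/! k * (r + 1ℚ - ℕ→ℚ k)
    ≡⟨ swap (fallingFactorial (r + 1ℚ) k) (1/! k) (r + 1ℚ - ℕ→ℚ k) ⟩
  fallingFactorial (r + 1ℚ) (suc k) * 1/! k
    ≡⟨ cong (_* 1/! k) (fallingFactorial-+1 r k) ⟩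
  (r + 1ℚ) * fallingFactorial r k * 1/! k
    ≡⟨ *-assoc (r + 1ℚ) (fallingFactorial r k) (1/! k) ⟩
  (r + 1ℚ) * binom r k ∎
  where
  swap : ∀ a b c → a * b * c ≡ a * c * b
  swap = solve-∀ ℚ-ring

binom-absorb₂ : ∀ r k → binom (r + 1ℚ + 1ℚ) (suc k) * (ℕ→ℚ (suc k) * (r + 1ℚ - ℕ→ℚ k))
                       ≡ (r + 1ℚ + 1ℚ) * (r + 1ℚ) * binom r k
binom-absorb₂ r k = begin
  binom (r + 1ℚ + 1ℚ) (suc k) * (ℕ→ℚ (suc k) * (r + 1ℚ - ℕ→ℚ k))
    ≡⟨ sym (*-assoc (binom (r + 1ℚ + 1ℚ) (suc k)) (ℕ→ℚ (suc k)) (r + 1ℚ - ℕ→ℚ k)) ⟩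
  binom (r + 1ℚ + 1ℚ) (suc k) * ℕ→ℚ (suc k) * (r + 1ℚ - ℕ→ℚ k)
    ≡⟨ cong (_* (r + 1ℚ - ℕ→ℚ k)) (binom-absorb (r + 1ℚ) k) ⟩
  (r + 1ℚ + 1ℚ) * binom (r + 1ℚ) k * (r + 1ℚ - ℕ→ℚ k)
    ≡⟨ *-assoc (r + 1ℚ + 1ℚ) (binom (r + 1ℚ) k) (r + 1ℚ - ℕ→ℚ k) ⟩
  (r + 1ℚ + 1ℚ) * (binom (r + 1ℚ) k * (r + 1ℚ - ℕ→ℚ k))
    ≡⟨ cong ((r + 1ℚ + 1ℚ) *_) (binom-absorb-complement r k) ⟩
  (r + 1ℚ + 1ℚ) * ((r + 1ℚ) * binom r k)
    ≡⟨ sym (*-assoc (r + 1ℚ + 1ℚ) (r + 1ℚ) (binom r k)) ⟩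
  (r + 1ℚ + 1ℚ) * (r + 1ℚ) * binom r k ∎

sumTo-cong : ∀ n {f g : ℕ → ℚ} → (∀ {m} → m ℕ.≤ n → f m ≡ g m) → sumTo n f ≡ sumTo n g
sumTo-cong zero    f≗g = f≗g ℕ.z≤n
sumTo-cong (suc n) f≗g = cong₂ _+_ (sumTo-cong n (λ m≤n → f≗g (ℕ.m≤n⇒m≤1+n m≤n))) (f≗g ℕ.≤-refl)

*-distribˡ-sumTo : ∀ n k (f : ℕ → ℚ) → k * sumTo n f ≡ sumTo n (λ m → k * f m)
*-distribˡ-sumTo zero    k f = refl
*-distribˡ-sumTo (suc n) k f = begin
  k * (sumTo n f + f (suc n))       ≡⟨ *-distribˡ-+ k (sumTo n f) (f (suc n)) ⟩
  k * sumTo n f + k * f (suc n)     ≡⟨ cong (_+ k * f (suc n)) (*-distribˡ-sumTo n k f) ⟩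
  sumTo n (λ m → k * f m) + k * f (suc n) ∎

sumTo-distrib-- : ∀ n (f g : ℕ → ℚ) → sumTo n (λ m → f m - g m) ≡ sumTo n f - sumTo n g
sumTo-distrib-- zero    f g = refl
sumTo-distrib-- (suc n) f g = begin
  sumTo n (λ m → f m - g m) + (f (suc n) - g (suc n))
    ≡⟨ cong (_+ (f (suc n) - g (suc n))) (sumTo-distrib-- n f g) ⟩
  sumTo n f - sumTo n g + (f (suc n) - g (suc n))
    ≡⟨ interchange (sumTo n f) (sumTo n g) (f (suc n)) (g (suc n)) ⟩
  sumTo n f + f (suc n) - (sumTo n g + g (suc n)) ∎
  where
  interchange : ∀ a b c d → a - b + (c - d) ≡ a + c - (b + d)
  interchange = solve-∀ ℚ-ring

sumTo-suc-first : ∀ n (f : ℕ → ℚ) → sumTo (suc n) f ≡ f 0 + sumTo n (λ m → f (suc m))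
sumTo-suc-first zero    f = refl
sumTo-suc-first (suc n) f = begin
  sumTo (suc n) f + f (suc (suc n))
    ≡⟨ cong (_+ f (suc (suc n))) (sumTo-suc-first n f) ⟩
  f 0 + sumTo n (λ m → f (suc m)) + f (suc (suc n))
    ≡⟨ +-assoc (f 0) (sumTo n (λ m → f (suc m))) (f (suc (suc n))) ⟩
  f 0 + sumTo (suc n) (λ m → f (suc m)) ∎

moment : ℕ → (ℕ → ℚ) → (ℕ → ℚ) → ℕ → ℚ
moment n c u j = sumTo n (λ m → c m * u m ^ℚ j)

moment-cong-scale : ∀ n j k {c c′ u u′ : ℕ → ℚ} →
  (∀ {m} → m ℕ.≤ n → c m ≡ k * c′ m) → (∀ {m} → m ℕ.≤ n → u m ≡ u′ m) →
  moment n c u j ≡ k * moment n c′ u′ j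
moment-cong-scale n j k {c} {c′} {u} {u′} c≗kc′ u≗u′ = begin
  moment n c u j
    ≡⟨ sumTo-cong n (λ m≤n → cong₂ (λ a b → a * b ^ℚ j) (c≗kc′ m≤n) (u≗u′ m≤n)) ⟩
  sumTo n (λ m → k * c′ m * u′ m ^ℚ j)
    ≡⟨ sumTo-cong n (λ {m} _ → *-assoc k (c′ m) (u′ m ^ℚ j)) ⟩
  sumTo n (λ m → k * (c′ m * u′ m ^ℚ j))
    ≡⟨ sym (*-distribˡ-sumTo n k (λ m → c′ m * u′ m ^ℚ j)) ⟩
  k * moment n c′ u′ j ∎

moment-suc-shift : ∀ n j a (c u : ℕ → ℚ) →
  moment n c u (suc j) - a * moment n c u j ≡ moment n (λ m → c m * (u m - a)) u j
moment-suc-shift n j a c u = begin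
  moment n c u (suc j) - a * moment n c u j
    ≡⟨ cong (λ s → moment n c u (suc j) - s) (*-distribˡ-sumTo n a (λ m → c m * u m ^ℚ j)) ⟩
  moment n c u (suc j) - sumTo n (λ m → a * (c m * u m ^ℚ j))
    ≡⟨ sym (sumTo-distrib-- n (λ m → c m * u m ^ℚ suc j) (λ m → a * (c m * u m ^ℚ j))) ⟩
  sumTo n (λ m → c m * u m ^ℚ suc j - a * (c m * u m ^ℚ j))
    ≡⟨ sumTo-cong n (λ {m} _ → factor (c m) (u m) a (u m ^ℚ j)) ⟩
  moment n (λ m → c m * (u m - a)) u j ∎
  where
  factor : ∀ c u a p → c * (u * p) - a * (c * p) ≡ c * (u - a) * p
  factor = solve-∀ ℚ-ring

moment-deflateʳ : ∀ n j (c u : ℕ → ℚ) →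
  moment (suc n) c u (suc j) - u (suc n) * moment (suc n) c u j
  ≡ moment n (λ m → c m * (u m - u (suc n))) u j
moment-deflateʳ n j c u = begin
  moment (suc n) c u (suc j) - u (suc n) * moment (suc n) c u j
    ≡⟨ moment-suc-shift (suc n) j (u (suc n)) c u ⟩
  moment n c′ u j + c (suc n) * (u (suc n) - u (suc n)) * u (suc n) ^ℚ j
    ≡⟨ vanishing-term (moment n c′ u j) (c (suc n)) (u (suc n)) (u (suc n) ^ℚ j) ⟩
  moment n c′ u j ∎
  where
  c′ = λ m → c m * (u m - u (suc n))
  vanishing-term : ∀ s c u p → s + c * (u - u) * p ≡ s
  vanishing-term = solve-∀ ℚ-ring

moment-deflateˡ : ∀ n j (c u : ℕ → ℚ) →
  moment (suc n) c u (suc j) - u 0 * moment (suc n) c u j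
  ≡ moment n (λ m → c (suc m) * (u (suc m) - u 0)) (λ m → u (suc m)) j
moment-deflateˡ n j c u = begin
  moment (suc n) c u (suc j) - u 0 * moment (suc n) c u j
    ≡⟨ moment-suc-shift (suc n) j (u 0) c u ⟩
  moment (suc n) (λ m → c m * (u m - u 0)) u j
    ≡⟨ sumTo-suc-first n (λ m → c m * (u m - u 0) * u m ^ℚ j) ⟩
  c 0 * (u 0 - u 0) * u 0 ^ℚ j + moment n (λ m → c (suc m) * (u (suc m) - u 0)) (λ m → u (suc m)) j
    ≡⟨ vanishing-term (moment n (λ m → c (suc m) * (u (suc m) - u 0)) (λ m → u (suc m)) j) (c 0) (u 0) (u 0 ^ℚ j) ⟩
  moment n (λ m → c (suc m) * (u (suc m) - u 0)) (λ m → u (suc m)) j ∎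
  where
  vanishing-term : ∀ s c u p → c * (u - u) * p + s ≡ s
  vanishing-term = solve-∀ ℚ-ring

square : ℚ → ℚ
square q = q * q

node : ℕ → ℚ → ℕ → ℚ
node n x m = x + ℕ→ℚ m + ℕ→ℚ m - ℕ→ℚ n

weight : ℕ → ℚ → ℕ → ℚ
weight n x m = binom (ℕ→ℚ n - x) m * binom (ℕ→ℚ n + x) (n ℕ.∸ m) * node n x m

binomialMoment : ℕ → ℚ → ℕ → ℚ
binomialMoment n x = moment n (weight n x) (λ m → square (node n x m))

κ⁻ κ⁺ : ℕ → ℚ → ℚ
κ⁻ n x = -4 * ((ℕ→ℚ n + 1ℚ + x) * (ℕ→ℚ n + x))
κ⁺ n x = -4 * ((ℕ→ℚ n + 1ℚ - x) * (ℕ→ℚ n - x))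

node-suc : ∀ n x m → node (suc n) x m ≡ node n (x - 1ℚ) m
node-suc n x m = trans (cong (λ t → x + ℕ→ℚ m + ℕ→ℚ m - t) (ℕ→ℚ-suc n)) (shift x (ℕ→ℚ m) (ℕ→ℚ n))
  where
  shift : ∀ x m n → x + m + m - (1ℚ + n) ≡ x - 1ℚ + m + m - n
  shift = solve-∀ ℚ-ring

node-suc-suc : ∀ n x m → node (suc n) x (suc m) ≡ node n (x + 1ℚ) m
node-suc-suc n x m = trans (cong₂ (λ s t → x + s + s - t) (ℕ→ℚ-suc m) (ℕ→ℚ-suc n)) (shift x (ℕ→ℚ m) (ℕ→ℚ n))
  where
  shift : ∀ x m n → x + (1ℚ + m) + (1ℚ + m) - (1ℚ + n) ≡ x + 1ℚ + m + m - n
  shift = solve-∀ ℚ-ring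

square-node-first-last : ∀ n x → square (node (suc n) x 0) - square (node (suc n) x (suc n)) ≡ -4 * (x * ℕ→ℚ (suc n))
square-node-first-last n x = begin
  square (x + 0ℚ + 0ℚ - N′) - square (x + N′ + N′ - N′)
    ≡⟨ cong (λ t → square (x + 0ℚ + 0ℚ - t) - square (x + t + t - t)) (ℕ→ℚ-suc n) ⟩
  square (x + 0ℚ + 0ℚ - (1ℚ + ℕ→ℚ n)) - square (x + (1ℚ + ℕ→ℚ n) + (1ℚ + ℕ→ℚ n) - (1ℚ + ℕ→ℚ n))
    ≡⟨ difference x (ℕ→ℚ n) ⟩
  -4 * (x * (1ℚ + ℕ→ℚ n))
    ≡⟨ cong (λ t → -4 * (x * t)) (sym (ℕ→ℚ-suc n)) ⟩
  -4 * (x * N′) ∎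
  where
  N′ = ℕ→ℚ (suc n)
  difference : ∀ x n → (x + 0ℚ + 0ℚ - (1ℚ + n)) * (x + 0ℚ + 0ℚ - (1ℚ + n))
                       - (x + (1ℚ + n) + (1ℚ + n) - (1ℚ + n)) * (x + (1ℚ + n) + (1ℚ + n) - (1ℚ + n))
                       ≡ -4 * (x * (1ℚ + n))
  difference = solve-∀ ℚ-ring

-- The right-hand sides of the next two lemmas have the shape (k + 1)(r + 1 − k) of binom-absorb₂.
square-node-sub-last : ∀ n x {m} → m ℕ.≤ n →
  square (node (suc n) x m) - square (node (suc n) x (suc n))
  ≡ -4 * (ℕ→ℚ (suc (n ℕ.∸ m)) * (ℕ→ℚ n + (x - 1ℚ) + 1ℚ - ℕ→ℚ (n ℕ.∸ m)))
square-node-sub-last n x {m} m≤n = begin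
  square (x + ℕ→ℚ m + ℕ→ℚ m - ℕ→ℚ (suc n)) - square (x + ℕ→ℚ (suc n) + ℕ→ℚ (suc n) - ℕ→ℚ (suc n))
    ≡⟨ cong (λ t → square (x + ℕ→ℚ m + ℕ→ℚ m - t) - square (x + t + t - t)) (ℕ→ℚ-suc n) ⟩
  square (x + ℕ→ℚ m + ℕ→ℚ m - (1ℚ + ℕ→ℚ n)) - square (x + (1ℚ + ℕ→ℚ n) + (1ℚ + ℕ→ℚ n) - (1ℚ + ℕ→ℚ n))
    ≡⟨ difference x (ℕ→ℚ n) (ℕ→ℚ m) ⟩
  -4 * ((1ℚ + (ℕ→ℚ n - ℕ→ℚ m)) * (ℕ→ℚ n + (x - 1ℚ) + 1ℚ - (ℕ→ℚ n - ℕ→ℚ m)))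
    ≡⟨ cong (λ t → -4 * ((1ℚ + t) * (ℕ→ℚ n + (x - 1ℚ) + 1ℚ - t))) (sym (ℕ→ℚ-∸ m≤n)) ⟩
  -4 * ((1ℚ + ℕ→ℚ (n ℕ.∸ m)) * (ℕ→ℚ n + (x - 1ℚ) + 1ℚ - ℕ→ℚ (n ℕ.∸ m)))
    ≡⟨ cong (λ t → -4 * (t * (ℕ→ℚ n + (x - 1ℚ) + 1ℚ - ℕ→ℚ (n ℕ.∸ m)))) (sym (ℕ→ℚ-suc (n ℕ.∸ m))) ⟩
  -4 * (ℕ→ℚ (suc (n ℕ.∸ m)) * (ℕ→ℚ n + (x - 1ℚ) + 1ℚ - ℕ→ℚ (n ℕ.∸ m))) ∎
  where
  difference : ∀ x n m →
    (x + m + m - (1ℚ + n)) * (x + m + m - (1ℚ + n)) - (x + (1ℚ + n) + (1ℚ + n) - (1ℚ + n)) * (x + (1ℚ + n) + (1ℚ + n) - (1ℚ + n))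
    ≡ -4 * ((1ℚ + (n - m)) * (n + (x - 1ℚ) + 1ℚ - (n - m)))
  difference = solve-∀ ℚ-ring

square-node-sub-first : ∀ n x m →
  square (node (suc n) x (suc m)) - square (node (suc n) x 0)
  ≡ -4 * (ℕ→ℚ (suc m) * (ℕ→ℚ n - (x + 1ℚ) + 1ℚ - ℕ→ℚ m))
square-node-sub-first n x m = begin
  square (x + ℕ→ℚ (suc m) + ℕ→ℚ (suc m) - ℕ→ℚ (suc n)) - square (x + 0ℚ + 0ℚ - ℕ→ℚ (suc n))
    ≡⟨ cong₂ (λ s t → square (x + s + s - t) - square (x + 0ℚ + 0ℚ - t)) (ℕ→ℚ-suc m) (ℕ→ℚ-suc n) ⟩
  square (x + (1ℚ + ℕ→ℚ m) + (1ℚ + ℕ→ℚ m) - (1ℚ + ℕ→ℚ n)) - square (x + 0ℚ + 0ℚ - (1ℚ + ℕ→ℚ n))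
    ≡⟨ difference x (ℕ→ℚ n) (ℕ→ℚ m) ⟩
  -4 * ((1ℚ + ℕ→ℚ m) * (ℕ→ℚ n - (x + 1ℚ) + 1ℚ - ℕ→ℚ m))
    ≡⟨ cong (λ t → -4 * (t * (ℕ→ℚ n - (x + 1ℚ) + 1ℚ - ℕ→ℚ m))) (sym (ℕ→ℚ-suc m)) ⟩
  -4 * (ℕ→ℚ (suc m) * (ℕ→ℚ n - (x + 1ℚ) + 1ℚ - ℕ→ℚ m)) ∎
  where
  difference : ∀ x n m →
    (x + (1ℚ + m) + (1ℚ + m) - (1ℚ + n)) * (x + (1ℚ + m) + (1ℚ + m) - (1ℚ + n)) - (x + 0ℚ + 0ℚ - (1ℚ + n)) * (x + 0ℚ + 0ℚ - (1ℚ + n))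
    ≡ -4 * ((1ℚ + m) * (n - (x + 1ℚ) + 1ℚ - m))
  difference = solve-∀ ℚ-ring

weight-step-down : ∀ n x {m} → m ℕ.≤ n →
  weight (suc n) x m * (square (node (suc n) x m) - square (node (suc n) x (suc n)))
  ≡ κ⁻ n x * weight n (x - 1ℚ) m
weight-step-down n x {m} m≤n = begin
  binom (ℕ→ℚ (suc n) - x) m * binom (ℕ→ℚ (suc n) + x) (suc n ℕ.∸ m) * node (suc n) x m
    * (square (node (suc n) x m) - square (node (suc n) x (suc n)))
    ≡⟨ cong₂ _*_ (cong₂ _*_ (cong₂ _*_ lower-binom upper-binom) (node-suc n x m)) (square-node-sub-last n x m≤n) ⟩
  B * binom (r + 1ℚ + 1ℚ) (suc k) * W * (-4 * (ℕ→ℚ (suc k) * (r + 1ℚ - ℕ→ℚ k)))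
    ≡⟨ regroup B (binom (r + 1ℚ + 1ℚ) (suc k)) W (ℕ→ℚ (suc k) * (r + 1ℚ - ℕ→ℚ k)) ⟩
  -4 * (B * W) * (binom (r + 1ℚ + 1ℚ) (suc k) * (ℕ→ℚ (suc k) * (r + 1ℚ - ℕ→ℚ k)))
    ≡⟨ cong (-4 * (B * W) *_) (binom-absorb₂ r k) ⟩
  -4 * (B * W) * ((r + 1ℚ + 1ℚ) * (r + 1ℚ) * binom r k)
    ≡⟨ collect (ℕ→ℚ n) x B W (binom r k) ⟩
  κ⁻ n x * weight n (x - 1ℚ) m ∎
  where
  k = n ℕ.∸ m
  r = ℕ→ℚ n + (x - 1ℚ)
  B = binom (ℕ→ℚ n - (x - 1ℚ)) m
  W = node n (x - 1ℚ) m
  lower-binom : binom (ℕ→ℚ (suc n) - x) m ≡ B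
  lower-binom = cong (λ t → binom t m) (trans (cong (_- x) (ℕ→ℚ-suc n)) (shift (ℕ→ℚ n) x))
    where
    shift : ∀ n x → 1ℚ + n - x ≡ n - (x - 1ℚ)
    shift = solve-∀ ℚ-ring
  upper-binom : binom (ℕ→ℚ (suc n) + x) (suc n ℕ.∸ m) ≡ binom (r + 1ℚ + 1ℚ) (suc k)
  upper-binom = cong₂ binom (trans (cong (_+ x) (ℕ→ℚ-suc n)) (shift (ℕ→ℚ n) x)) (ℕ.+-∸-assoc 1 m≤n)
    where
    shift : ∀ n x → 1ℚ + n + x ≡ n + (x - 1ℚ) + 1ℚ + 1ℚ
    shift = solve-∀ ℚ-ring
  regroup : ∀ b c w d → b * c * w * (-4 * d) ≡ -4 * (b * w) * (c * d)
  regroup = solve-∀ ℚ-ring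
  collect : ∀ n x b w c → -4 * (b * w) * ((n + (x - 1ℚ) + 1ℚ + 1ℚ) * (n + (x - 1ℚ) + 1ℚ) * c)
                          ≡ -4 * ((n + 1ℚ + x) * (n + x)) * (b * c * w)
  collect = solve-∀ ℚ-ring

weight-step-up : ∀ n x {m} → m ℕ.≤ n →
  weight (suc n) x (suc m) * (square (node (suc n) x (suc m)) - square (node (suc n) x 0))
  ≡ κ⁺ n x * weight n (x + 1ℚ) m
weight-step-up n x {m} m≤n = begin
  binom (ℕ→ℚ (suc n) - x) (suc m) * binom (ℕ→ℚ (suc n) + x) (n ℕ.∸ m) * node (suc n) x (suc m)
    * (square (node (suc n) x (suc m)) - square (node (suc n) x 0))
    ≡⟨ cong₂ _*_ (cong₂ _*_ (cong₂ _*_ lower-binom upper-binom) (node-suc-suc n x m)) (square-node-sub-first n x m) ⟩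
  binom (r + 1ℚ + 1ℚ) (suc m) * B * W * (-4 * (ℕ→ℚ (suc m) * (r + 1ℚ - ℕ→ℚ m)))
    ≡⟨ regroup (binom (r + 1ℚ + 1ℚ) (suc m)) B W (ℕ→ℚ (suc m) * (r + 1ℚ - ℕ→ℚ m)) ⟩
  -4 * (B * W) * (binom (r + 1ℚ + 1ℚ) (suc m) * (ℕ→ℚ (suc m) * (r + 1ℚ - ℕ→ℚ m)))
    ≡⟨ cong (-4 * (B * W) *_) (binom-absorb₂ r m) ⟩
  -4 * (B * W) * ((r + 1ℚ + 1ℚ) * (r + 1ℚ) * binom r m)
    ≡⟨ collect (ℕ→ℚ n) x B W (binom r m) ⟩
  κ⁺ n x * weight n (x + 1ℚ) m ∎
  where
  r = ℕ→ℚ n - (x + 1ℚ)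
  B = binom (ℕ→ℚ n + (x + 1ℚ)) (n ℕ.∸ m)
  W = node n (x + 1ℚ) m
  lower-binom : binom (ℕ→ℚ (suc n) - x) (suc m) ≡ binom (r + 1ℚ + 1ℚ) (suc m)
  lower-binom = cong (λ t → binom t (suc m)) (trans (cong (_- x) (ℕ→ℚ-suc n)) (shift (ℕ→ℚ n) x))
    where
    shift : ∀ n x → 1ℚ + n - x ≡ n - (x + 1ℚ) + 1ℚ + 1ℚ
    shift = solve-∀ ℚ-ring
  upper-binom : binom (ℕ→ℚ (suc n) + x) (n ℕ.∸ m) ≡ B
  upper-binom = cong (λ t → binom t (n ℕ.∸ m)) (trans (cong (_+ x) (ℕ→ℚ-suc n)) (shift (ℕ→ℚ n) x))
    where
    shift : ∀ n x → 1ℚ + n + x ≡ n + (x + 1ℚ)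
    shift = solve-∀ ℚ-ring
  regroup : ∀ c b w d → c * b * w * (-4 * d) ≡ -4 * (b * w) * (c * d)
  regroup = solve-∀ ℚ-ring
  collect : ∀ n x b w c → -4 * (b * w) * ((n - (x + 1ℚ) + 1ℚ + 1ℚ) * (n - (x + 1ℚ) + 1ℚ) * c)
                          ≡ -4 * ((n + 1ℚ - x) * (n - x)) * (c * b * w)
  collect = solve-∀ ℚ-ring

binomialMoment-step-down : ∀ n x j →
  binomialMoment (suc n) x (suc j) - square (node (suc n) x (suc n)) * binomialMoment (suc n) x j
  ≡ κ⁻ n x * binomialMoment n (x - 1ℚ) j
binomialMoment-step-down n x j =
  trans (moment-deflateʳ n j (weight (suc n) x) (λ m → square (node (suc n) x m)))
        (moment-cong-scale n j (κ⁻ n x) (weight-step-down n x) (λ {m} _ → cong square (node-suc n x m)))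

binomialMoment-step-up : ∀ n x j →
  binomialMoment (suc n) x (suc j) - square (node (suc n) x 0) * binomialMoment (suc n) x j
  ≡ κ⁺ n x * binomialMoment n (x + 1ℚ) j
binomialMoment-step-up n x j =
  trans (moment-deflateˡ n j (weight (suc n) x) (λ m → square (node (suc n) x m)))
        (moment-cong-scale n j (κ⁺ n x) (weight-step-up n x) (λ {m} _ → cong square (node-suc-suc n x m)))

centredProduct : ℕ → ℚ → ℚ
centredProduct n x = fallingFactorial (x + ℕ→ℚ n) (2 ℕ.* n ℕ.+ 1)

ℕ→ℚ-2n+1 : ∀ n → ℕ→ℚ (2 ℕ.* n ℕ.+ 1) ≡ ℕ→ℚ n + ℕ→ℚ n + 1ℚ
ℕ→ℚ-2n+1 n = begin
  ℕ→ℚ (2 ℕ.* n ℕ.+ 1)       ≡⟨ ℕ→ℚ-homo-+ (2 ℕ.* n) 1 ⟩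
  ℕ→ℚ (2 ℕ.* n) + 1ℚ        ≡⟨ cong (λ t → ℕ→ℚ t + 1ℚ) (cong (n ℕ.+_) (ℕ.+-identityʳ n)) ⟩
  ℕ→ℚ (n ℕ.+ n) + 1ℚ        ≡⟨ cong (_+ 1ℚ) (ℕ→ℚ-homo-+ n n) ⟩
  ℕ→ℚ n + ℕ→ℚ n + 1ℚ        ∎

centredProduct-suc-unfold : ∀ n x →
  centredProduct (suc n) x ≡ fallingFactorial (x + ℕ→ℚ n + 1ℚ) (suc (suc (2 ℕ.* n ℕ.+ 1)))
centredProduct-suc-unfold n x =
  cong₂ fallingFactorial (trans (cong (λ t → x + t) (ℕ→ℚ-suc n)) (shift x (ℕ→ℚ n))) (2[1+n]+1≡2+[2n+1] n)
  where
  shift : ∀ x n → x + (1ℚ + n) ≡ x + n + 1ℚ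
  shift = solve-∀ ℚ-ring

centredProduct-suc : ∀ n x →
  centredProduct (suc n) x ≡ (x + ℕ→ℚ n + 1ℚ) * centredProduct n x * (x - ℕ→ℚ n - 1ℚ)
centredProduct-suc n x = begin
  centredProduct (suc n) x
    ≡⟨ centredProduct-suc-unfold n x ⟩
  fallingFactorial (x + ℕ→ℚ n + 1ℚ) (suc (suc (2 ℕ.* n ℕ.+ 1)))
    ≡⟨ fallingFactorial-+1 (x + ℕ→ℚ n) (suc (2 ℕ.* n ℕ.+ 1)) ⟩
  (x + ℕ→ℚ n + 1ℚ) * (centredProduct n x * (x + ℕ→ℚ n - ℕ→ℚ (2 ℕ.* n ℕ.+ 1)))
    ≡⟨ cong (λ t → (x + ℕ→ℚ n + 1ℚ) * (centredProduct n x * (x + ℕ→ℚ n - t))) (ℕ→ℚ-2n+1 n) ⟩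
  (x + ℕ→ℚ n + 1ℚ) * (centredProduct n x * (x + ℕ→ℚ n - (ℕ→ℚ n + ℕ→ℚ n + 1ℚ)))
    ≡⟨ regroup x (ℕ→ℚ n) (centredProduct n x) ⟩
  (x + ℕ→ℚ n + 1ℚ) * centredProduct n x * (x - ℕ→ℚ n - 1ℚ) ∎
  where
  regroup : ∀ x n p → (x + n + 1ℚ) * (p * (x + n - (n + n + 1ℚ))) ≡ (x + n + 1ℚ) * p * (x - n - 1ℚ)
  regroup = solve-∀ ℚ-ring

centredProduct-suc-down : ∀ n x →
  centredProduct (suc n) x ≡ (ℕ→ℚ n + 1ℚ + x) * (ℕ→ℚ n + x) * centredProduct n (x - 1ℚ)
centredProduct-suc-down n x = begin
  centredProduct (suc n) x
    ≡⟨ centredProduct-suc-unfold n x ⟩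
  fallingFactorial (x + ℕ→ℚ n + 1ℚ) (suc (suc k))
    ≡⟨ fallingFactorial-+1 (x + ℕ→ℚ n) (suc k) ⟩
  (x + ℕ→ℚ n + 1ℚ) * fallingFactorial (x + ℕ→ℚ n) (suc k)
    ≡⟨ cong (λ t → (x + ℕ→ℚ n + 1ℚ) * fallingFactorial t (suc k)) (shift x (ℕ→ℚ n)) ⟩
  (x + ℕ→ℚ n + 1ℚ) * fallingFactorial (x - 1ℚ + ℕ→ℚ n + 1ℚ) (suc k)
    ≡⟨ cong ((x + ℕ→ℚ n + 1ℚ) *_) (fallingFactorial-+1 (x - 1ℚ + ℕ→ℚ n) k) ⟩
  (x + ℕ→ℚ n + 1ℚ) * ((x - 1ℚ + ℕ→ℚ n + 1ℚ) * centredProduct n (x - 1ℚ))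
    ≡⟨ regroup x (ℕ→ℚ n) (centredProduct n (x - 1ℚ)) ⟩
  (ℕ→ℚ n + 1ℚ + x) * (ℕ→ℚ n + x) * centredProduct n (x - 1ℚ) ∎
  where
  k = 2 ℕ.* n ℕ.+ 1
  shift : ∀ x n → x + n ≡ x - 1ℚ + n + 1ℚ
  shift = solve-∀ ℚ-ring
  regroup : ∀ x n p → (x + n + 1ℚ) * ((x - 1ℚ + n + 1ℚ) * p) ≡ (n + 1ℚ + x) * (n + x) * p
  regroup = solve-∀ ℚ-ring

centredProduct-suc-up : ∀ n x →
  centredProduct (suc n) x ≡ (ℕ→ℚ n + 1ℚ - x) * (ℕ→ℚ n - x) * centredProduct n (x + 1ℚ)
centredProduct-suc-up n x = begin
  centredProduct (suc n) x
    ≡⟨ centredProduct-suc-unfold n x ⟩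
  fallingFactorial r k * (r - ℕ→ℚ k) * (r - ℕ→ℚ (suc k))
    ≡⟨ cong₂ (λ t s → fallingFactorial t k * (r - s) * (r - ℕ→ℚ (suc k))) (shift x (ℕ→ℚ n)) (ℕ→ℚ-2n+1 n) ⟩
  centredProduct n (x + 1ℚ) * (r - (ℕ→ℚ n + ℕ→ℚ n + 1ℚ)) * (r - ℕ→ℚ (suc k))
    ≡⟨ cong (λ t → centredProduct n (x + 1ℚ) * (r - (ℕ→ℚ n + ℕ→ℚ n + 1ℚ)) * (r - t))
            (trans (ℕ→ℚ-suc k) (cong (λ t → 1ℚ + t) (ℕ→ℚ-2n+1 n))) ⟩
  centredProduct n (x + 1ℚ) * (r - (ℕ→ℚ n + ℕ→ℚ n + 1ℚ)) * (r - (1ℚ + (ℕ→ℚ n + ℕ→ℚ n + 1ℚ)))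
    ≡⟨ regroup x (ℕ→ℚ n) (centredProduct n (x + 1ℚ)) ⟩
  (ℕ→ℚ n + 1ℚ - x) * (ℕ→ℚ n - x) * centredProduct n (x + 1ℚ) ∎
  where
  k = 2 ℕ.* n ℕ.+ 1
  r = x + ℕ→ℚ n + 1ℚ
  shift : ∀ x n → x + n + 1ℚ ≡ x + 1ℚ + n
  shift = solve-∀ ℚ-ring
  regroup : ∀ x n p → p * (x + n + 1ℚ - (n + n + 1ℚ)) * (x + n + 1ℚ - (1ℚ + (n + n + 1ℚ)))
                      ≡ (n + 1ℚ - x) * (n - x) * p
  regroup = solve-∀ ℚ-ring

topMoment : ℕ → ℚ → ℚ
topMoment n x = (-4) ^ℚ n * centredProduct n x

κ⁻-topMoment : ∀ n x → κ⁻ n x * topMoment n (x - 1ℚ) ≡ topMoment (suc n) x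
κ⁻-topMoment n x = begin
  -4 * ((ℕ→ℚ n + 1ℚ + x) * (ℕ→ℚ n + x)) * ((-4) ^ℚ n * centredProduct n (x - 1ℚ))
    ≡⟨ regroup (-4 ^ℚ n) ((ℕ→ℚ n + 1ℚ + x) * (ℕ→ℚ n + x)) (centredProduct n (x - 1ℚ)) ⟩
  -4 * (-4) ^ℚ n * ((ℕ→ℚ n + 1ℚ + x) * (ℕ→ℚ n + x) * centredProduct n (x - 1ℚ))
    ≡⟨ cong (-4 * (-4) ^ℚ n *_) (sym (centredProduct-suc-down n x)) ⟩
  topMoment (suc n) x ∎
  where
  regroup : ∀ q a p → -4 * a * (q * p) ≡ -4 * q * (a * p)
  regroup = solve-∀ ℚ-ring

κ⁺-topMoment : ∀ n x → κ⁺ n x * topMoment n (x + 1ℚ) ≡ topMoment (suc n) x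
κ⁺-topMoment n x = begin
  -4 * ((ℕ→ℚ n + 1ℚ - x) * (ℕ→ℚ n - x)) * ((-4) ^ℚ n * centredProduct n (x + 1ℚ))
    ≡⟨ regroup (-4 ^ℚ n) ((ℕ→ℚ n + 1ℚ - x) * (ℕ→ℚ n - x)) (centredProduct n (x + 1ℚ)) ⟩
  -4 * (-4) ^ℚ n * ((ℕ→ℚ n + 1ℚ - x) * (ℕ→ℚ n - x) * centredProduct n (x + 1ℚ))
    ≡⟨ cong (-4 * (-4) ^ℚ n *_) (sym (centredProduct-suc-up n x)) ⟩
  topMoment (suc n) x ∎
  where
  regroup : ∀ q a p → -4 * a * (q * p) ≡ -4 * q * (a * p)
  regroup = solve-∀ ℚ-ring

NonInteger : ℚ → Set
NonInteger x = ∀ z → x ≢ ℤ→ℚ z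

NonInteger⇒≢0 : ∀ {x} → NonInteger x → x ≢ 0ℚ
NonInteger⇒≢0 x∉ℤ = x∉ℤ (+ 0)

NonInteger-+ : ∀ {x} z → NonInteger x → NonInteger (x + ℤ→ℚ z)
NonInteger-+ {x} z x∉ℤ w x+z≡w = x∉ℤ (w ℤ.- z) (begin
  x                          ≡⟨ cancel x (ℤ→ℚ z) ⟩
  x + ℤ→ℚ z - ℤ→ℚ z          ≡⟨ cong (_- ℤ→ℚ z) x+z≡w ⟩
  ℤ→ℚ w - ℤ→ℚ z              ≡⟨ cong (λ t → ℤ→ℚ w + t) (sym (ℤ→ℚ-homo‿- z)) ⟩
  ℤ→ℚ w + ℤ→ℚ (ℤ.- z)        ≡⟨ sym (ℤ→ℚ-homo-+ w (ℤ.- z)) ⟩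
  ℤ→ℚ (w ℤ.- z)              ∎)
  where
  cancel : ∀ x z → x ≡ x + z - z
  cancel = solve-∀ ℚ-ring

NonInteger-−1 : ∀ {x} → NonInteger x → NonInteger (x - 1ℚ)
NonInteger-−1 = NonInteger-+ -[1+ 0 ]

NonInteger-+1 : ∀ {x} → NonInteger x → NonInteger (x + 1ℚ)
NonInteger-+1 = NonInteger-+ (+ 1)

binomialMoment-cross : ∀ n x j →
  -4 * (x * (ℕ→ℚ (suc n) * binomialMoment (suc n) x j))
  ≡ κ⁻ n x * binomialMoment n (x - 1ℚ) j - κ⁺ n x * binomialMoment n (x + 1ℚ) j
binomialMoment-cross n x j = begin
  -4 * (x * (ℕ→ℚ (suc n) * S j))                  ≡⟨ reassoc x (ℕ→ℚ (suc n)) (S j) ⟩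
  -4 * (x * ℕ→ℚ (suc n)) * S j                    ≡⟨ cong (_* S j) (sym (square-node-first-last n x)) ⟩
  (u₀ - uₗ) * S j                                 ≡⟨ telescope (S (suc j)) u₀ uₗ (S j) ⟩
  (S (suc j) - uₗ * S j) - (S (suc j) - u₀ * S j) ≡⟨ cong₂ _-_ (binomialMoment-step-down n x j) (binomialMoment-step-up n x j) ⟩
  κ⁻ n x * binomialMoment n (x - 1ℚ) j - κ⁺ n x * binomialMoment n (x + 1ℚ) j ∎
  where
  S  = binomialMoment (suc n) x
  u₀ = square (node (suc n) x 0)
  uₗ = square (node (suc n) x (suc n))
  reassoc : ∀ x y s → -4 * (x * (y * s)) ≡ -4 * (x * y) * s
  reassoc = solve-∀ ℚ-ring
  telescope : ∀ s u₀ uₗ t → (u₀ - uₗ) * t ≡ (s - uₗ * t) - (s - u₀ * t)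
  telescope = solve-∀ ℚ-ring

binomialMoment-vanishes : ∀ n {x} j → NonInteger x →
  κ⁻ n x * binomialMoment n (x - 1ℚ) j - κ⁺ n x * binomialMoment n (x + 1ℚ) j ≡ 0ℚ →
  binomialMoment (suc n) x j ≡ 0ℚ
binomialMoment-vanishes n {x} j x∉ℤ cross≡0 =
  x≢0⇒x*y≡0⇒y≡0 (ℕ→ℚ-suc≢0 n) (x≢0⇒x*y≡0⇒y≡0 (NonInteger⇒≢0 x∉ℤ)
    (x≢0⇒x*y≡0⇒y≡0 { -4} (λ ()) (trans (binomialMoment-cross n x j) cross≡0)))

binomialMoments : ∀ n x → NonInteger x →
  (∀ {j} → j ℕ.< n → binomialMoment n x j ≡ 0ℚ) × (binomialMoment n x n ≡ topMoment n x)
binomialMoments zero    x _   = (λ ()) , base x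
  where
  base : ∀ x → 1ℚ * 1ℚ * (1ℚ * 1ℚ) * (x + 0ℚ + 0ℚ - 0ℚ) * 1ℚ ≡ 1ℚ * (1ℚ * (x + 0ℚ - 0ℚ))
  base = solve-∀ ℚ-ring
binomialMoments (suc n) x x∉ℤ = vanishing , top
  where
  S  = binomialMoment (suc n) x
  S⁻ = binomialMoment n (x - 1ℚ)
  S⁺ = binomialMoment n (x + 1ℚ)
  uₗ = square (node (suc n) x (suc n))
  ih⁻ = binomialMoments n (x - 1ℚ) (NonInteger-−1 x∉ℤ)
  ih⁺ = binomialMoments n (x + 1ℚ) (NonInteger-+1 x∉ℤ)

  vanishing : ∀ {j} → j ℕ.< suc n → S j ≡ 0ℚ
  vanishing {j} j<1+n with ℕ.m<1+n⇒m<n∨m≡n j<1+n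
  ... | inj₁ j<n  = binomialMoment-vanishes n j x∉ℤ (begin
    κ⁻ n x * S⁻ j - κ⁺ n x * S⁺ j ≡⟨ cong₂ (λ a b → κ⁻ n x * a - κ⁺ n x * b) (proj₁ ih⁻ j<n) (proj₁ ih⁺ j<n) ⟩
    κ⁻ n x * 0ℚ - κ⁺ n x * 0ℚ     ≡⟨ annihilate (κ⁻ n x) (κ⁺ n x) ⟩
    0ℚ                            ∎)
    where
    annihilate : ∀ a b → a * 0ℚ - b * 0ℚ ≡ 0ℚ
    annihilate = solve-∀ ℚ-ring
  ... | inj₂ refl = binomialMoment-vanishes n n x∉ℤ (begin
    κ⁻ n x * S⁻ n - κ⁺ n x * S⁺ n ≡⟨ cong₂ (λ a b → κ⁻ n x * a - κ⁺ n x * b) (proj₂ ih⁻) (proj₂ ih⁺) ⟩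
    κ⁻ n x * topMoment n (x - 1ℚ) - κ⁺ n x * topMoment n (x + 1ℚ)
      ≡⟨ cong₂ _-_ (κ⁻-topMoment n x) (κ⁺-topMoment n x) ⟩
    topMoment (suc n) x - topMoment (suc n) x ≡⟨ +-inverseʳ (topMoment (suc n) x) ⟩
    0ℚ                            ∎)

  top : S (suc n) ≡ topMoment (suc n) x
  top = begin
    S (suc n)                               ≡⟨ split (S (suc n)) uₗ (S n) ⟩
    (S (suc n) - uₗ * S n) + uₗ * S n       ≡⟨ cong₂ (λ a b → a + uₗ * b) (binomialMoment-step-down n x n) (vanishing ℕ.≤-refl) ⟩
    κ⁻ n x * S⁻ n + uₗ * 0ℚ                 ≡⟨ cong (λ a → κ⁻ n x * a + uₗ * 0ℚ) (proj₂ ih⁻) ⟩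
    κ⁻ n x * topMoment n (x - 1ℚ) + uₗ * 0ℚ ≡⟨ drop (κ⁻ n x * topMoment n (x - 1ℚ)) uₗ ⟩
    κ⁻ n x * topMoment n (x - 1ℚ)           ≡⟨ κ⁻-topMoment n x ⟩
    topMoment (suc n) x                     ∎
    where
    split : ∀ s u t → s ≡ (s - u * t) + u * t
    split = solve-∀ ℚ-ring
    drop : ∀ a u → a + u * 0ℚ ≡ a
    drop = solve-∀ ℚ-ring

⅓ : ℚ
⅓ = + 1 / 3

NonInteger-⅓ : NonInteger ⅓
NonInteger-⅓ z ⅓≡z with cong ℚ.denominator-1 (trans ⅓≡z (ℤ→ℚ≡fromℤ z))
... | ()

ℤ→ℚ-1-3n+6m : ∀ n m → ℤ→ℚ (+ 1 ℤ.- + (3 ℕ.* n) ℤ.+ + (6 ℕ.* m)) ≡ ℕ→ℚ 3 * node n ⅓ m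
ℤ→ℚ-1-3n+6m n m = begin
  ℤ→ℚ (+ 1 ℤ.- + (3 ℕ.* n) ℤ.+ + (6 ℕ.* m))
    ≡⟨ ℤ→ℚ-homo-+ (+ 1 ℤ.- + (3 ℕ.* n)) (+ (6 ℕ.* m)) ⟩
  ℤ→ℚ (+ 1 ℤ.- + (3 ℕ.* n)) + ℕ→ℚ (6 ℕ.* m)
    ≡⟨ cong₂ _+_ (trans (ℤ→ℚ-homo-+ (+ 1) (ℤ.- + (3 ℕ.* n))) (cong (λ t → 1ℚ + t) (ℤ→ℚ-homo‿- (+ (3 ℕ.* n)))))
                 (ℕ→ℚ-homo-* 6 m) ⟩
  1ℚ + - ℕ→ℚ (3 ℕ.* n) + ℕ→ℚ 6 * ℕ→ℚ m
    ≡⟨ cong (λ t → 1ℚ + - t + ℕ→ℚ 6 * ℕ→ℚ m) (ℕ→ℚ-homo-* 3 n) ⟩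
  1ℚ + - (ℕ→ℚ 3 * ℕ→ℚ n) + ℕ→ℚ 6 * ℕ→ℚ m
    ≡⟨ expand (ℕ→ℚ n) (ℕ→ℚ m) ⟩
  ℕ→ℚ 3 * node n ⅓ m ∎
  where
  expand : ∀ n m → 1ℚ + - (ℕ→ℚ 3 * n) + ℕ→ℚ 6 * m ≡ ℕ→ℚ 3 * (⅓ + m + m - n)
  expand = solve-∀ ℚ-ring

ℕ→ℚ-[3+t]! : ∀ t → ℕ→ℚ ((3 ℕ.+ t) !) ≡ (ℕ→ℚ 3 + ℕ→ℚ t) * ((ℕ→ℚ 2 + ℕ→ℚ t) * ((ℕ→ℚ 1 + ℕ→ℚ t) * ℕ→ℚ (t !)))
ℕ→ℚ-[3+t]! t = begin
  ℕ→ℚ ((3 ℕ.+ t) !)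
    ≡⟨ ℕ→ℚ-homo-* (3 ℕ.+ t) ((2 ℕ.+ t) !) ⟩
  ℕ→ℚ (3 ℕ.+ t) * ℕ→ℚ ((2 ℕ.+ t) !)
    ≡⟨ cong (ℕ→ℚ (3 ℕ.+ t) *_) (ℕ→ℚ-homo-* (2 ℕ.+ t) ((1 ℕ.+ t) !)) ⟩
  ℕ→ℚ (3 ℕ.+ t) * (ℕ→ℚ (2 ℕ.+ t) * ℕ→ℚ ((1 ℕ.+ t) !))
    ≡⟨ cong (λ f → ℕ→ℚ (3 ℕ.+ t) * (ℕ→ℚ (2 ℕ.+ t) * f)) (ℕ→ℚ-homo-* (1 ℕ.+ t) (t !)) ⟩
  ℕ→ℚ (3 ℕ.+ t) * (ℕ→ℚ (2 ℕ.+ t) * (ℕ→ℚ (1 ℕ.+ t) * ℕ→ℚ (t !)))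
    ≡⟨ cong₂ (λ a b → a * (b * (ℕ→ℚ (1 ℕ.+ t) * ℕ→ℚ (t !)))) (ℕ→ℚ-homo-+ 3 t) (ℕ→ℚ-homo-+ 2 t) ⟩
  (ℕ→ℚ 3 + ℕ→ℚ t) * ((ℕ→ℚ 2 + ℕ→ℚ t) * (ℕ→ℚ (1 ℕ.+ t) * ℕ→ℚ (t !)))
    ≡⟨ cong (λ c → (ℕ→ℚ 3 + ℕ→ℚ t) * ((ℕ→ℚ 2 + ℕ→ℚ t) * (c * ℕ→ℚ (t !)))) (ℕ→ℚ-homo-+ 1 t) ⟩
  (ℕ→ℚ 3 + ℕ→ℚ t) * ((ℕ→ℚ 2 + ℕ→ℚ t) * ((ℕ→ℚ 1 + ℕ→ℚ t) * ℕ→ℚ (t !))) ∎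

factorialQuotient : ℕ → ℚ
factorialQuotient n = ℕ→ℚ ((3 ℕ.* n ℕ.+ 1) !) * 1/! n

factorialQuotient-suc : ∀ n → factorialQuotient (suc n)
  ≡ ℕ→ℚ 3 * ((ℕ→ℚ 3 * ℕ→ℚ n + ℕ→ℚ 2) * (ℕ→ℚ 3 * ℕ→ℚ n + ℕ→ℚ 4)) * factorialQuotient n
factorialQuotient-suc n = begin
  ℕ→ℚ ((3 ℕ.* suc n ℕ.+ 1) !) * 1/! (suc n)
    ≡⟨ cong (λ k → ℕ→ℚ (k !) * 1/! (suc n)) (cong (ℕ._+ 1) (ℕ.*-suc 3 n)) ⟩
  ℕ→ℚ ((3 ℕ.+ t) !) * 1/! (suc n)
    ≡⟨ cong (_* 1/! (suc n)) (ℕ→ℚ-[3+t]! t) ⟩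
  (ℕ→ℚ 3 + ℕ→ℚ t) * ((ℕ→ℚ 2 + ℕ→ℚ t) * ((ℕ→ℚ 1 + ℕ→ℚ t) * ℕ→ℚ (t !))) * 1/! (suc n)
    ≡⟨ cong (λ c → (ℕ→ℚ 3 + c) * ((ℕ→ℚ 2 + c) * ((ℕ→ℚ 1 + c) * ℕ→ℚ (t !))) * 1/! (suc n)) ℕ→ℚ-t ⟩
  (ℕ→ℚ 3 + (ℕ→ℚ 3 * ℕ→ℚ n + 1ℚ)) * ((ℕ→ℚ 2 + (ℕ→ℚ 3 * ℕ→ℚ n + 1ℚ)) * ((ℕ→ℚ 1 + (ℕ→ℚ 3 * ℕ→ℚ n + 1ℚ)) * ℕ→ℚ (t !))) * 1/! (suc n)
    ≡⟨ regroup (ℕ→ℚ n) (ℕ→ℚ (t !)) (1/! (suc n)) ⟩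
  ℕ→ℚ 3 * ((ℕ→ℚ 3 * ℕ→ℚ n + ℕ→ℚ 2) * (ℕ→ℚ 3 * ℕ→ℚ n + ℕ→ℚ 4)) * (ℕ→ℚ (t !) * (1/! (suc n) * (1ℚ + ℕ→ℚ n)))
    ≡⟨ cong (λ c → ℕ→ℚ 3 * ((ℕ→ℚ 3 * ℕ→ℚ n + ℕ→ℚ 2) * (ℕ→ℚ 3 * ℕ→ℚ n + ℕ→ℚ 4)) * (ℕ→ℚ (t !) * c))
            (trans (cong (1/! (suc n) *_) (sym (ℕ→ℚ-suc n))) (1/!-suc n)) ⟩
  ℕ→ℚ 3 * ((ℕ→ℚ 3 * ℕ→ℚ n + ℕ→ℚ 2) * (ℕ→ℚ 3 * ℕ→ℚ n + ℕ→ℚ 4)) * factorialQuotient n ∎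
  where
  t = 3 ℕ.* n ℕ.+ 1
  ℕ→ℚ-t : ℕ→ℚ t ≡ ℕ→ℚ 3 * ℕ→ℚ n + 1ℚ
  ℕ→ℚ-t = trans (ℕ→ℚ-homo-+ (3 ℕ.* n) 1) (cong (_+ 1ℚ) (ℕ→ℚ-homo-* 3 n))
  regroup : ∀ n f i →
    (ℕ→ℚ 3 + (ℕ→ℚ 3 * n + 1ℚ)) * ((ℕ→ℚ 2 + (ℕ→ℚ 3 * n + 1ℚ)) * ((ℕ→ℚ 1 + (ℕ→ℚ 3 * n + 1ℚ)) * f)) * i
    ≡ ℕ→ℚ 3 * ((ℕ→ℚ 3 * n + ℕ→ℚ 2) * (ℕ→ℚ 3 * n + ℕ→ℚ 4)) * (f * (i * (1ℚ + n)))
  regroup = solve-∀ ℚ-ring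

centred-evaluation-at-⅓ : ∀ n →
  ℕ→ℚ 3 ^ℚ (2 ℕ.* n ℕ.+ 1) * topMoment n ⅓ ≡ (+ 4 / 3) ^ℚ n * factorialQuotient n
centred-evaluation-at-⅓ zero    = refl
centred-evaluation-at-⅓ (suc n) = begin
  ℕ→ℚ 3 ^ℚ (2 ℕ.* suc n ℕ.+ 1) * topMoment (suc n) ⅓
    ≡⟨ cong₂ (λ e c → ℕ→ℚ 3 ^ℚ e * (-4 * F * c)) (2[1+n]+1≡2+[2n+1] n) (centredProduct-suc n ⅓) ⟩
  ℕ→ℚ 3 * (ℕ→ℚ 3 * E) * (-4 * F * ((⅓ + ℕ→ℚ n + 1ℚ) * R * (⅓ - ℕ→ℚ n - 1ℚ)))
    ≡⟨ regroup E F R (ℕ→ℚ n) ⟩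
  ℕ→ℚ 4 * g * (E * (F * R))
    ≡⟨ cong (ℕ→ℚ 4 * g *_) (centred-evaluation-at-⅓ n) ⟩
  ℕ→ℚ 4 * g * ((+ 4 / 3) ^ℚ n * factorialQuotient n)
    ≡⟨ regroup′ ((+ 4 / 3) ^ℚ n) g (factorialQuotient n) ⟩
  (+ 4 / 3) * (+ 4 / 3) ^ℚ n * (ℕ→ℚ 3 * g * factorialQuotient n)
    ≡⟨ cong ((+ 4 / 3) * (+ 4 / 3) ^ℚ n *_) (sym (factorialQuotient-suc n)) ⟩
  (+ 4 / 3) ^ℚ suc n * factorialQuotient (suc n) ∎
  where
  E = ℕ→ℚ 3 ^ℚ (2 ℕ.* n ℕ.+ 1)
  F = (-4) ^ℚ n
  R = centredProduct n ⅓
  g = (ℕ→ℚ 3 * ℕ→ℚ n + ℕ→ℚ 2) * (ℕ→ℚ 3 * ℕ→ℚ n + ℕ→ℚ 4)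
  regroup : ∀ e f r n → ℕ→ℚ 3 * (ℕ→ℚ 3 * e) * (-4 * f * ((⅓ + n + 1ℚ) * r * (⅓ - n - 1ℚ)))
                        ≡ ℕ→ℚ 4 * ((ℕ→ℚ 3 * n + ℕ→ℚ 2) * (ℕ→ℚ 3 * n + ℕ→ℚ 4)) * (e * (f * r))
  regroup = solve-∀ ℚ-ring
  regroup′ : ∀ q g f → ℕ→ℚ 4 * g * (q * f) ≡ (+ 4 / 3) * q * (ℕ→ℚ 3 * g * f)
  regroup′ = solve-∀ ℚ-ring

corollary2p2 : (n : ℕ) → n ≥ 1 →
    sumTo n (λ m → binom (ℕ→ℚ n - + 1 / 3) m * binom (ℕ→ℚ n + + 1 / 3) (n ℕ.∸ m)
                     * (ℤ→ℚ (+ 1 ℤ.- + (3 ℕ.* n) ℤ.+ + (6 ℕ.* m)) ^ℚ (2 ℕ.* n ℕ.+ 1)))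
    ≡ ((+ 4 / 3) ^ℚ n) * (+ ((3 ℕ.* n ℕ.+ 1) !) / (n !)) {{n !≢0}}
corollary2p2 n _ = begin
  sumTo n (λ m → binom (ℕ→ℚ n - ⅓) m * binom (ℕ→ℚ n + ⅓) (n ℕ.∸ m)
                   * (ℤ→ℚ (+ 1 ℤ.- + (3 ℕ.* n) ℤ.+ + (6 ℕ.* m)) ^ℚ (2 ℕ.* n ℕ.+ 1)))
    ≡⟨ sumTo-cong n (λ {m} _ → summand m) ⟩
  sumTo n (λ m → E * (weight n ⅓ m * square (node n ⅓ m) ^ℚ n))
    ≡⟨ sym (*-distribˡ-sumTo n E (λ m → weight n ⅓ m * square (node n ⅓ m) ^ℚ n)) ⟩
  E * binomialMoment n ⅓ n
    ≡⟨ cong (E *_) (proj₂ (binomialMoments n ⅓ NonInteger-⅓)) ⟩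
  E * topMoment n ⅓
    ≡⟨ centred-evaluation-at-⅓ n ⟩
  (+ 4 / 3) ^ℚ n * factorialQuotient n
    ≡⟨ cong ((+ 4 / 3) ^ℚ n *_) (sym (/-split ((3 ℕ.* n ℕ.+ 1) !) (n !) {{n !≢0}})) ⟩
  (+ 4 / 3) ^ℚ n * (+ ((3 ℕ.* n ℕ.+ 1) !) / (n !)) {{n !≢0}} ∎
  where
  E = ℕ→ℚ 3 ^ℚ (2 ℕ.* n ℕ.+ 1)
  summand : ∀ m → binom (ℕ→ℚ n - ⅓) m * binom (ℕ→ℚ n + ⅓) (n ℕ.∸ m)
                    * ℤ→ℚ (+ 1 ℤ.- + (3 ℕ.* n) ℤ.+ + (6 ℕ.* m)) ^ℚ (2 ℕ.* n ℕ.+ 1)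
                  ≡ E * (weight n ⅓ m * square (node n ⅓ m) ^ℚ n)
  summand m = begin
    B * ℤ→ℚ (+ 1 ℤ.- + (3 ℕ.* n) ℤ.+ + (6 ℕ.* m)) ^ℚ (2 ℕ.* n ℕ.+ 1)
      ≡⟨ cong (λ z → B * z ^ℚ (2 ℕ.* n ℕ.+ 1)) (ℤ→ℚ-1-3n+6m n m) ⟩
    B * (ℕ→ℚ 3 * W) ^ℚ (2 ℕ.* n ℕ.+ 1)
      ≡⟨ cong (B *_) (trans (^ℚ-distribʳ-* (ℕ→ℚ 3) W (2 ℕ.* n ℕ.+ 1)) (cong (E *_) (^ℚ-odd W n))) ⟩
    B * (E * (W * square W ^ℚ n))
      ≡⟨ regroup B E W (square W ^ℚ n) ⟩
    E * (B * W * square W ^ℚ n) ∎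
    where
    B = binom (ℕ→ℚ n - ⅓) m * binom (ℕ→ℚ n + ⅓) (n ℕ.∸ m)
    W = node n ⅓ m
    regroup : ∀ b e w p → b * (e * (w * p)) ≡ e * (b * w * p)
    regroup = solve-∀ ℚ-ring
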